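{- Let $\mathbb{P}=(\mathcal{G},(\mathcal{D},\sqsubseteq),\delta)$ be a pattern setup. A description $d\in\mathcal{D}$ is support-closed if and only if there exists $A\subseteq\mathcal{G}$ with $d\in cov^*(A)$. Consequently, the set of all support-closed descriptions is $\mathcal{D}^*=\bigcup_{A\subseteq\mathcal{G}}cov^*(A)$.
   Context: A pattern setup is a triple $(\mathcal{G},(\mathcal{D},\sqsubseteq),\delta)$ with $\mathcal{G}$ a set, $(\mathcal{D},\sqsubseteq)$ a poset and $\delta:\mathcal{G}\to\mathcal{D}$ a map. $ext(d)=\{g\in\mathcal{G}\mid d\sqsubseteq\delta(g)\}$; $cov(A)=\{d\in\mathcal{D}\mid\forall g\in A,\ d\sqsubseteq\delta(g)\}$; $cov^*(A)=\max(cov(A))$, the set of maximal elements of $cov(A)$ with respect to $\sqsubseteq$. A description $d$ is support-closed if for all $c\in\mathcal{D}$ with $d\sqsubseteq c$ and $d\neq c$ we have $ext(c)\subsetneq ext(d)$. -}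

module Defs where

open import Level using (Level; _⊔_)
open import Relation.Binary.Bundles using (Poset)
open import Relation.Unary using (Pred; _∈_; _∉_; _⊆_)
open import Relation.Nullary using (¬_)
open import Data.Product using (Σ; _×_; ∃-syntax)

-- A pattern setup (G, (D, ⊑), δ): G a set, (D, ⊑) a poset, δ : G → D.
-- Equality of descriptions is the poset's equivalence _≈_.
record PatternSetup (g c ℓ₁ ℓ₂ : Level) : Set (Level.suc (g ⊔ c ⊔ ℓ₁ ⊔ ℓ₂)) where
  field
    G : Set g
    D : Poset c ℓ₁ ℓ₂
  open Poset D public using (Carrier; _≈_; _≤_)
  field
    δ : G → Carrier

module Setup {g c ℓ₁ ℓ₂ : Level} (P : PatternSetup g c ℓ₁ ℓ₂) where
  open PatternSetup P

  ext : Carrier → Pred G ℓ₂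
  ext d x = d ≤ δ x

  cov : {ℓ : Level} → Pred G ℓ → Pred Carrier (g ⊔ ℓ ⊔ ℓ₂)
  cov A d = ∀ {x} → x ∈ A → d ≤ δ x

  max : {ℓ : Level} → Pred Carrier ℓ → Pred Carrier (c ⊔ ℓ ⊔ ℓ₁ ⊔ ℓ₂)
  max S d = d ∈ S × (∀ {e} → e ∈ S → d ≤ e → e ≈ d)

  cov* : {ℓ : Level} → Pred G ℓ → Pred Carrier (g ⊔ c ⊔ ℓ ⊔ ℓ₁ ⊔ ℓ₂)
  cov* A = max (cov A)

  _⊊_ : {ℓ : Level} → Pred G ℓ → Pred G ℓ → Set (g ⊔ ℓ)
  X ⊊ Y = X ⊆ Y × ∃[ x ] (x ∈ Y × x ∉ X)

  SupportClosed : Carrier → Set (g ⊔ c ⊔ ℓ₁ ⊔ ℓ₂)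
  SupportClosed d = ∀ e → d ≤ e → ¬ (d ≈ e) → ext e ⊊ ext d

  -- D* = ⋃_{A ⊆ G} cov*(A)  (subsets A of G as predicates G → Set g)
  D* : Pred Carrier (Level.suc g ⊔ c ⊔ ℓ₁ ⊔ ℓ₂)
  D* d = ∃[ A ] (d ∈ cov* {g} A)

module Submission where

-- Both directions compare the extent of d with the extent of a description
-- e ⊒ d, using that extents shrink as descriptions grow (ext-antitone).
--   (⇒) Take A = ext(d).  d covers its own extent, and any e ⊒ d covering
--       ext(d) has ext(d) ⊆ ext(e), so support-closedness forces e ≈ d.
--   (⇐) If d ∈ cov*(A) and d ⊏ e, then ext(e) ⊆ ext(d); were the inclusion
--       not strict, e would cover A ⊆ ext(d) ⊆ ext(e), and maximality of d
--       would give e ≈ d.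
-- The argument is classical: excluded middle decides d ≈ e, splits inclusion
-- into "⊆ or some element escapes" (⊆-or-escapes), and resizes ext(d), a
-- predicate of level ℓ₂, into a subset of G of level g (the extent ext↓).

open import Defs
open import Level using (Level; _⊔_; Lift; lift; lower)
open import Axiom.ExcludedMiddle using (ExcludedMiddle)
open import Data.Product using (_×_; ∃-syntax; _,_)
open import Data.Sum using (_⊎_; inj₁; inj₂)
open import Data.Empty using (⊥-elim)
open import Relation.Unary using (Pred; _∈_; _∉_; _⊆_)
open import Relation.Nullary using (yes; no)
open import Relation.Nullary.Decidable using (map′; True; toWitness; fromWitness)
open import Relation.Binary.Bundles using (Poset)
open import Function.Bundles using (_⇔_; mk⇔)

em-lower : ∀ {a b} → ExcludedMiddle (a ⊔ b) → ExcludedMiddle a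
em-lower {b = b} em {P} = map′ lower lift (em {Lift b P})

⊆-or-escapes : ∀ {a ℓx ℓy} {A : Set a} → ExcludedMiddle (a ⊔ ℓx ⊔ ℓy) →
  (X : Pred A ℓx) (Y : Pred A ℓy) → X ⊆ Y ⊎ ∃[ x ] (x ∈ X × x ∉ Y)
⊆-or-escapes {a} {ℓx} {ℓy} em X Y with em {∃[ x ] (x ∈ X × x ∉ Y)}
... | yes escape = inj₂ escape
... | no no-escape = inj₁ X⊆Y
  where
  X⊆Y : X ⊆ Y
  X⊆Y {x} x∈X with em-lower {ℓy} {a ⊔ ℓx} em {x ∈ Y}
  ... | yes x∈Y = x∈Y
  ... | no x∉Y = ⊥-elim (no-escape (x , x∈X , x∉Y))

module SupportClosure {g c ℓ₁ ℓ₂ : Level}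
                      (em : ExcludedMiddle (g ⊔ c ⊔ ℓ₁ ⊔ ℓ₂))
                      (P : PatternSetup g c ℓ₁ ℓ₂) where
  open PatternSetup P
  open Setup P
  open Poset D using (trans; module Eq)

  ext-antitone : ∀ {d e} → d ≤ e → ext e ⊆ ext d
  ext-antitone d≤e e≤δx = trans d≤e e≤δx

  -- ext(d) resized to a subset of G of level g, as cov* {g} requires.
  ext↓ : Carrier → Pred G g
  ext↓ d x = Lift g (True (em-lower {ℓ₂} {g ⊔ c ⊔ ℓ₁} em {d ≤ δ x}))

  ext⊆ext↓ : ∀ {d} → ext d ⊆ ext↓ d
  ext⊆ext↓ d≤δx = lift (fromWitness d≤δx)

  ext↓⊆ext : ∀ {d} → ext↓ d ⊆ ext d
  ext↓⊆ext (lift t) = toWitness t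

  closed⇒cov* : ∀ {d} → SupportClosed d → d ∈ cov* (ext↓ d)
  closed⇒cov* {d} closed = ext↓⊆ext , maximal
    where
    maximal : ∀ {e} → e ∈ cov (ext↓ d) → d ≤ e → e ≈ d
    maximal {e} e-covers d≤e with em-lower {ℓ₁} {g ⊔ c ⊔ ℓ₂} em {d ≈ e}
    ... | yes d≈e = Eq.sym d≈e
    ... | no d≉e with closed e d≤e d≉e
    ...   | _ , x , x∈ext-d , x∉ext-e = ⊥-elim (x∉ext-e (e-covers (ext⊆ext↓ x∈ext-d)))

  cov*⇒closed : ∀ {ℓ} {A : Pred G ℓ} {d} → d ∈ cov* A → SupportClosed d
  cov*⇒closed {d = d} (d-covers , maximal) e d≤e d≉e = ext-antitone d≤e , escape
    where
    escape : ∃[ x ] (x ∈ ext d × x ∉ ext e)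
    escape with ⊆-or-escapes (em-lower {g ⊔ ℓ₂} {c ⊔ ℓ₁} em) (ext d) (ext e)
    ... | inj₂ witness = witness
    ... | inj₁ ext-d⊆ext-e =
      ⊥-elim (d≉e (Eq.sym (maximal (λ x∈A → ext-d⊆ext-e (d-covers x∈A)) d≤e)))

proposition5p3 : {g c ℓ₁ ℓ₂ : Level} → ExcludedMiddle (g ⊔ c ⊔ ℓ₁ ⊔ ℓ₂) →
    (P : PatternSetup g c ℓ₁ ℓ₂) →
    let open PatternSetup P
        open Setup P
    in (∀ d → (SupportClosed d ⇔ (∃[ A ] (d ∈ cov* {g} A))))
       × (SupportClosed ⊆ D* × D* ⊆ SupportClosed)
proposition5p3 em P = (λ d → mk⇔ closed⇒D* D*⇒closed) , closed⇒D* , D*⇒closed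
  where
  open PatternSetup P
  open Setup P
  open SupportClosure em P

  closed⇒D* : SupportClosed ⊆ D*
  closed⇒D* {d} closed = ext↓ d , closed⇒cov* closed

  D*⇒closed : D* ⊆ SupportClosed
  D*⇒closed (_ , d∈cov*) = cov*⇒closed d∈cov*
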